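{- Let $G=\{\cdot\mid *\}$, $H=\{\cdot\mid1\}$, and $\mathcal{U}=\mathcal{D}(\{G,H\})$. Then $G\not\equiv_{\mathcal{U}}0$.
   Context: Games are finite partizan games $\{\mathscr{G}^L\mid\mathscr{G}^R\}$, $\cdot$ denoting no options; $0=\{\cdot\mid\cdot\}$, $*=\{0\mid0\}$, $1=\{0\mid\cdot\}$. Sum $G+H=\{G^L+H,G+H^L\mid G^R+H,G+H^R\}$; conjugate $\overline{G}=\{\overline{G^R}\mid\overline{G^L}\}$. Misère outcomes: $o^L(G)=\mathscr{L}$ iff $G$ has no Left option or some $o^R(G^L)=\mathscr{L}$ (else $\mathscr{R}$); $o^R(G)=\mathscr{R}$ iff $G$ has no Right option or some $o^L(G^R)=\mathscr{R}$ (else $\mathscr{L}$); $o(G)$ is the pair $(o^L(G),o^R(G))$. A universe is a set of games closed under options, sums, conjugates, and forming $\{\mathscr{S}\mid\mathscr{T}\}$ for nonempty finite subsets $\mathscr{S},\mathscr{T}$; $\mathcal{D}(\mathcal{A})$ is the smallest universe containing $\mathcal{A}$. $G\equiv_{\mathcal{U}}H$ means $o(G+X)=o(H+X)$ for all $X\in\mathcal{U}$. -}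

module Defs where

open import Data.Nat using (ℕ; zero; suc; _+_)
open import Data.Fin using (Fin; zero; suc; splitAt)
open import Data.Bool using (Bool; true; false; _∨_; if_then_else_)
open import Data.Sum using (_⊎_; inj₁; inj₂; [_,_])
open import Data.Product using (_×_; _,_)
open import Relation.Binary.PropositionalEquality using (_≡_)

data Game : Set where
  mk : (m n : ℕ) → (Fin m → Game) → (Fin n → Game) → Game

zeroG : Game
zeroG = mk 0 0 (λ ()) (λ ())

star : Game
star = mk 1 1 (λ _ → zeroG) (λ _ → zeroG)

oneG : Game
oneG = mk 1 0 (λ _ → zeroG) (λ ())

infixl 6 _⊕_
_⊕_ : Game → Game → Game
G@(mk m n f g) ⊕ H@(mk p q h k) =
  mk (m + p) (n + q)
     (λ i → [ (λ a → f a ⊕ H) , (λ b → G ⊕ h b) ] (splitAt m i))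
     (λ j → [ (λ a → g a ⊕ H) , (λ b → G ⊕ k b) ] (splitAt n j))

conj : Game → Game
conj (mk m n f g) = mk n m (λ j → conj (g j)) (λ i → conj (f i))

data Player : Set where
  𝓛 𝓡 : Player

isL : Player → Bool
isL 𝓛 = true
isL 𝓡 = false

isR : Player → Bool
isR 𝓛 = false
isR 𝓡 = true

anyFin : ∀ {m} → (Fin m → Bool) → Bool
anyFin {zero} p = false
anyFin {suc m} p = p zero ∨ anyFin (λ i → p (suc i))

mutual
  oL : Game → Player
  oL (mk zero n f g) = 𝓛
  oL (mk (suc m) n f g) = if anyFin (λ i → isL (oR (f i))) then 𝓛 else 𝓡

  oR : Game → Player
  oR (mk m zero f g) = 𝓡
  oR (mk m (suc n) f g) = if anyFin (λ j → isR (oL (g j))) then 𝓡 else 𝓛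

outcome : Game → Player × Player
outcome G = oL G , oR G

data 𝒟 (A : Game → Set) : Game → Set where
  base     : ∀ {X} → A X → 𝒟 A X
  leftOpt  : ∀ {m n f g} → 𝒟 A (mk m n f g) → (i : Fin m) → 𝒟 A (f i)
  rightOpt : ∀ {m n f g} → 𝒟 A (mk m n f g) → (j : Fin n) → 𝒟 A (g j)
  sum      : ∀ {X Y} → 𝒟 A X → 𝒟 A Y → 𝒟 A (X ⊕ Y)
  conjCl   : ∀ {X} → 𝒟 A X → 𝒟 A (conj X)
  form     : ∀ {m n} (f : Fin (suc m) → Game) (g : Fin (suc n) → Game) →
             (∀ i → 𝒟 A (f i)) → (∀ j → 𝒟 A (g j)) →
             𝒟 A (mk (suc m) (suc n) f g)

_≡[_]_ : Game → (Game → Set) → Game → Set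
G ≡[ U ] H = ∀ X → U X → outcome (G ⊕ X) ≡ outcome (H ⊕ X)

Gp : Game
Gp = mk 0 1 (λ ()) (λ _ → star)

Hp : Game
Hp = mk 0 1 (λ ()) (λ _ → oneG)

𝒜GH : Game → Set
𝒜GH X = (X ≡ Gp) ⊎ (X ≡ Hp)

-- The game 1 + 1 (an element of 𝒰, since 1 is the Right option of H)
-- distinguishes G from 0. Left moving first in 1 + 1 must play to 1, where
-- Right has no move and so wins in misère play. In G + 1 + 1 Left plays to
-- G + 1; Right's only move is to * + 1, from which Left moves to * and wins,
-- because Right's only move there is to 0, leaving Left without a move.
module Submission where

open import Defs
open import Relation.Nullary using (¬_)
open import Relation.Binary.PropositionalEquality using (_≡_; refl; sym; cong; module ≡-Reasoning)
open import Data.Product using (proj₁)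
open import Data.Sum using (inj₂)
open import Data.Fin using (zero)

one∈𝒰 : 𝒟 𝒜GH oneG
one∈𝒰 = rightOpt (base {X = Hp} (inj₂ refl)) zero

two : Game
two = oneG ⊕ oneG

two∈𝒰 : 𝒟 𝒜GH two
two∈𝒰 = sum one∈𝒰 one∈𝒰

oL-Gp⊕two : oL (Gp ⊕ two) ≡ 𝓛
oL-Gp⊕two = refl

oL-zero⊕two : oL (zeroG ⊕ two) ≡ 𝓡
oL-zero⊕two = refl

𝓛≢𝓡 : ¬ (𝓛 ≡ 𝓡)
𝓛≢𝓡 ()

proposition7p4 : ¬ (Gp ≡[ 𝒟 𝒜GH ] zeroG)
proposition7p4 G≡0 = 𝓛≢𝓡 (begin
  𝓛                ≡⟨ sym oL-Gp⊕two ⟩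
  oL (Gp ⊕ two)    ≡⟨ cong proj₁ (G≡0 two two∈𝒰) ⟩
  oL (zeroG ⊕ two) ≡⟨ oL-zero⊕two ⟩
  𝓡                ∎)
  where open ≡-Reasoning
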